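{- For every $k\ge1$ and $r\in\widehat X$, setting $\widetilde M^{(k)}(r):=M^{(k)}(3^kr)$, we have \[\widetilde M^{(k)}(r)=\frac{1}{3^k}\prod_{0\le\ell<k}\Big(1-e\big(-2^{\ell}3^{k-\ell-1}r\big)+e\big(-2^{\ell+1}3^{k-\ell-1}r\big)\Big).\]
   Context: Let $X=\mathbb{Z}_2=\{(x_n)_{n\ge0}\in\prod_n\mathbb{Z}/2^n\mathbb{Z} : x_{n+1}\equiv x_n\pmod{2^n}\}$ be the ring of $2$-adic integers with coordinate-wise operations and $\pi_n$ the $n$-th coordinate. Let $\widehat X=\mathbb{Q}[1/2]/\mathbb{Z}$, with integer multiples $m r$ of $r\in\widehat X$ taken in this group. For $\mathbf{x}\in X$, $P_{\mathbf{x}}:\widehat X\to\widehat X$ is $P_{\mathbf{x}}(\tfrac{a}{2^n}+\mathbb{Z})=\tfrac{\pi_n(\mathbf{x})a}{2^n}+\mathbb{Z}$. Let $e(\alpha)=\exp(2\pi i\alpha)$ (well defined modulo $1$). Let $\mathbf{q}\in X$ be the multiplicative inverse of $\mathbf{3}=(3)_n$ and $2\mathbf{q}=(2)_n\cdot\mathbf{q}$. Define $M(r)=\tfrac13\big(1-e(-P_{\mathbf{q}}(r))+e(-P_{\mathbf{q}}(r))^2\big)$ and $M^{(k)}(r)=\prod_{0\le\ell<k}M\big(P_{2\mathbf{q}}^{\ell}(r)\big)$, where $P_{2\mathbf{q}}^{\ell}$ is the $\ell$-th iterate. -}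

module Defs where

open import Level using (Level)
open import Data.Nat as ℕ using (ℕ; zero; suc; _<_; _^_)
open import Data.Nat.Properties using (m^n≢0)
open import Data.Integer as ℤ using (ℤ; +_)
open import Data.Integer.Divisibility using (_∣_)
open import Data.Product using (_×_)
open import Relation.Binary.PropositionalEquality using (_≡_)
open import Algebra.Bundles using (CommutativeRing)

_%2^_ : ℕ → ℕ → ℕ
a %2^ n = ℕ._%_ a (2 ^ n) {{m^n≢0 2 n}}

-- X = ℤ₂ : compatible sequences (x_n) with x_n ∈ ℤ/2^nℤ (represented by 0 ≤ x_n < 2^n)
record ℤ₂ : Set where
  field
    π      : ℕ → ℕ
    bound  : ∀ n → π n < 2 ^ n
    compat : ∀ n → π (suc n) %2^ n ≡ π n
open ℤ₂ public

-- X̂ = ℚ[1/2]/ℤ : a representative  mk n a  stands for  a/2^n + ℤ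
record X̂ : Set where
  constructor mk
  field
    den : ℕ
    num : ℤ
open X̂ public

-- equality in ℚ[1/2]/ℤ :  a/2^n ≡ b/2^m (mod 1)  iff  2^(n+m) ∣ a·2^m − b·2^n
_≈̂_ : X̂ → X̂ → Set
mk n a ≈̂ mk m b = (+ (2 ^ (n ℕ.+ m))) ∣ (a ℤ.* + (2 ^ m) ℤ.- b ℤ.* + (2 ^ n))

zeroX̂ : X̂
zeroX̂ = mk 0 (+ 0)

_+̂_ : X̂ → X̂ → X̂
mk n a +̂ mk m b = mk (n ℕ.+ m) (a ℤ.* + (2 ^ m) ℤ.+ b ℤ.* + (2 ^ n))

-̂_ : X̂ → X̂
-̂ mk n a = mk n (ℤ.- a)

_·̂_ : ℤ → X̂ → X̂
c ·̂ mk n a = mk n (c ℤ.* a)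

P : ℤ₂ → X̂ → X̂
P x (mk n a) = mk n (+ (π x n) ℤ.* a)

IsInverseOf3 : ℤ₂ → Set
IsInverseOf3 q = ∀ n → (3 ℕ.* π q n) %2^ n ≡ 1 %2^ n

2·_ : ℤ₂ → ℕ → ℕ
(2· q) n = (2 ℕ.* π q n) %2^ n

P2 : ℤ₂ → X̂ → X̂
P2 q (mk n a) = mk n (+ ((2· q) n) ℤ.* a)

iterate : {A : Set} → (A → A) → ℕ → A → A
iterate f zero    a = a
iterate f (suc ℓ) a = f (iterate f ℓ a)

module _ {c ℓ : Level} (R : CommutativeRing c ℓ) where
  open CommutativeRing R

  -- a character e : (X̂,+) → (R,·) ; e(α) = exp(2πiα) in ℂ is an instance
  record IsCharacter (e : X̂ → Carrier) : Set (c Level.⊔ ℓ) where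
    field
      resp : ∀ {r s} → r ≈̂ s → e r ≈ e s
      e-0  : e zeroX̂ ≈ 1#
      e-+  : ∀ r s → e (r +̂ s) ≈ e r * e s

  ∏< : ℕ → (ℕ → Carrier) → Carrier
  ∏< zero    f = 1#
  ∏< (suc k) f = ∏< k f * f k

  pow : Carrier → ℕ → Carrier
  pow x zero    = 1#
  pow x (suc k) = pow x k * x

  module Setup (e : X̂ → Carrier) (third : Carrier) (q : ℤ₂) where
    M : X̂ → Carrier
    M r = third * ((1# - E) + E * E)
      where E = e (-̂ P q r)

    M^ : ℕ → X̂ → Carrier
    M^ k r = ∏< k (λ l → M (iterate (P2 q) l r))

    M̃ : ℕ → X̂ → Carrier
    M̃ k r = M^ k ((+ (3 ^ k)) ·̂ r)

    RHS : ℕ → X̂ → Carrier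
    RHS k r = pow third k *
      ∏< k (λ l → (1# - e (-̂ ((+ (2 ^ l ℕ.* 3 ^ (k ℕ.∸ l ℕ.∸ 1))) ·̂ r)))
                 + e (-̂ ((+ (2 ^ suc l ℕ.* 3 ^ (k ℕ.∸ l ℕ.∸ 1))) ·̂ r)))

-- On a/2^n + ℤ the maps P_q and P_{2q} are multiplication by q_n and 2q_n, so the ℓ-th
-- factor of M^(k)(3^k r) evaluates e at −q(2q)^ℓ 3^k r = −(3q)^(ℓ+1) 2^ℓ 3^(k−ℓ−1) r.
-- As 3q ≡ 1 (mod 2^n), this is −2^ℓ 3^(k−ℓ−1) r in ℚ[1/2]/ℤ, and e(−x)² = e(−2x) because
-- e is a character; the k constant factors 1/3 then collect into 1/3^k.
module Submission where

open import Defs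
open import Level using (Level)
open import Data.Nat as ℕ using (ℕ; zero; suc; _≤_; _<_; _∸_; _^_; NonZero; s≤s)
open import Data.Nat.DivMod using (_%_; _/_; m≡m%n+[m/n]*n; %-distribˡ-*; m%n%n≡m%n)
import Data.Nat.Properties as ℕₚ
open import Data.Integer as ℤ using (ℤ; +_)
import Data.Integer.Properties as ℤₚ
import Data.Integer.Divisibility.Signed as Signed
import Data.Nat.Divisibility as ℕ∣
open import Data.List using (_∷_; [])
open import Function using (_∘_)
open import Relation.Binary.PropositionalEquality
  using (_≡_; refl; sym; trans; cong; cong₂; subst; subst₂; module ≡-Reasoning)
import Data.Nat.Tactic.RingSolver as ℕ-Solver
import Data.Integer.Tactic.RingSolver as ℤ-Solver
open import Algebra.Bundles using (CommutativeRing)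
import Algebra.Properties.CommutativeSemigroup as CommutativeSemigroupProperties
open import Algebra.Properties.Ring ℤₚ.+-*-ring using ([y-z]x≈yx-zx)
import Relation.Binary.Reasoning.Setoid as SetoidReasoning

module Congruence (d : ℕ) .{{_ : NonZero d}} where

  infix 4 _≋_
  _≋_ : ℕ → ℕ → Set
  m ≋ n = m % d ≡ n % d

  %-≋ : ∀ m → m % d ≋ m
  %-≋ m = m%n%n≡m%n m d

  *-≋ : ∀ {m m′ n n′} → m ≋ m′ → n ≋ n′ → m ℕ.* n ≋ m′ ℕ.* n′
  *-≋ {m} {m′} {n} {n′} m≋m′ n≋n′ = begin
    (m ℕ.* n) % d               ≡⟨ %-distribˡ-* m n d ⟩
    ((m % d) ℕ.* (n % d)) % d   ≡⟨ cong₂ (λ x y → (x ℕ.* y) % d) m≋m′ n≋n′ ⟩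
    ((m′ % d) ℕ.* (n′ % d)) % d ≡⟨ %-distribˡ-* m′ n′ d ⟨
    (m′ ℕ.* n′) % d             ∎
    where open ≡-Reasoning

  m≋n⇒d∣m-n : ∀ {m n} → m ≋ n → + d Signed.∣ + m ℤ.- + n
  m≋n⇒d∣m-n {m} {n} m≋n = Signed.divides (+ (m / d) ℤ.- + (n / d)) (begin
    + m ℤ.- + n
      ≡⟨ cong₂ ℤ._-_ (split m) (split n) ⟩
    (+ (m % d) ℤ.+ + (m / d) ℤ.* + d) ℤ.- (+ (n % d) ℤ.+ + (n / d) ℤ.* + d)
      ≡⟨ cong (λ x → (+ (m % d) ℤ.+ + (m / d) ℤ.* + d) ℤ.- (+ x ℤ.+ + (n / d) ℤ.* + d)) m≋n ⟨
    (+ (m % d) ℤ.+ + (m / d) ℤ.* + d) ℤ.- (+ (m % d) ℤ.+ + (n / d) ℤ.* + d)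
      ≡⟨ [r+αd]-[r+βd]≡[α-β]d (+ (m % d)) (+ (m / d)) (+ (n / d)) (+ d) ⟩
    (+ (m / d) ℤ.- + (n / d)) ℤ.* + d ∎)
    where
    open ≡-Reasoning
    [r+αd]-[r+βd]≡[α-β]d : ∀ r α β d → (r ℤ.+ α ℤ.* d) ℤ.- (r ℤ.+ β ℤ.* d) ≡ (α ℤ.- β) ℤ.* d
    [r+αd]-[r+βd]≡[α-β]d = ℤ-Solver.solve-∀
    split : ∀ x → + x ≡ + (x % d) ℤ.+ + (x / d) ℤ.* + d
    split x = begin
      + x                                ≡⟨ cong +_ (m≡m%n+[m/n]*n x d) ⟩
      + (x % d ℕ.+ x / d ℕ.* d)          ≡⟨ ℤₚ.pos-+ (x % d) (x / d ℕ.* d) ⟩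
      + (x % d) ℤ.+ + (x / d ℕ.* d)      ≡⟨ cong (λ y → + (x % d) ℤ.+ y) (ℤₚ.pos-* (x / d) d) ⟩
      + (x % d) ℤ.+ + (x / d) ℤ.* + d    ∎

m<n⇒suc[m+[n∸m∸1]]≡n : ∀ {m n} → m < n → suc (m ℕ.+ (n ∸ m ∸ 1)) ≡ n
m<n⇒suc[m+[n∸m∸1]]≡n {zero}  {suc n} _         = refl
m<n⇒suc[m+[n∸m∸1]]≡n {suc m} {suc n} (s≤s m<n) = cong suc (m<n⇒suc[m+[n∸m∸1]]≡n m<n)

-- Used with d = 2^n, q = π_n(q) and t = π_n(2q).
module InverseOfThree {d} .{{_ : NonZero d}} {q t : ℕ} where
  open Congruence d
  open CommutativeSemigroupProperties ℕₚ.*-commutativeSemigroup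
    using () renaming (interchange to *-interchange)

  module _ (3q≋1 : 3 ℕ.* q ≋ 1) (t≋2q : t ≋ 2 ℕ.* q) where

    t*3≋2 : t ℕ.* 3 ≋ 2
    t*3≋2 = begin
      (t ℕ.* 3) % d         ≡⟨ *-≋ t≋2q refl ⟩
      (2 ℕ.* q ℕ.* 3) % d   ≡⟨ cong (_% d) (ℕ-Solver.solve (q ∷ [])) ⟩
      (2 ℕ.* (3 ℕ.* q)) % d ≡⟨ *-≋ {2} refl 3q≋1 ⟩
      2 % d                 ∎
      where open ≡-Reasoning

    t^l*3^l≋2^l : ∀ l → t ^ l ℕ.* 3 ^ l ≋ 2 ^ l
    t^l*3^l≋2^l zero    = refl
    t^l*3^l≋2^l (suc l) = begin
      (t ^ suc l ℕ.* 3 ^ suc l) % d           ≡⟨ cong (_% d) (*-interchange t (t ^ l) 3 (3 ^ l)) ⟩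
      ((t ℕ.* 3) ℕ.* (t ^ l ℕ.* 3 ^ l)) % d  ≡⟨ *-≋ t*3≋2 (t^l*3^l≋2^l l) ⟩
      2 ^ suc l % d                          ∎
      where open ≡-Reasoning

    q*t^l*3^[1+l+j]≋2^l*3^j : ∀ l j → q ℕ.* (t ^ l ℕ.* 3 ^ suc (l ℕ.+ j)) ≋ 2 ^ l ℕ.* 3 ^ j
    q*t^l*3^[1+l+j]≋2^l*3^j l j = begin
      (q ℕ.* (t ^ l ℕ.* 3 ^ suc (l ℕ.+ j))) % d
        ≡⟨ cong (λ x → (q ℕ.* (t ^ l ℕ.* (3 ℕ.* x))) % d) (ℕₚ.^-distribˡ-+-* 3 l j) ⟩
      (q ℕ.* (t ^ l ℕ.* (3 ℕ.* (3 ^ l ℕ.* 3 ^ j)))) % d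
        ≡⟨ cong (_% d) (rearrange q (t ^ l) (3 ^ l) (3 ^ j)) ⟩
      ((3 ℕ.* q) ℕ.* ((t ^ l ℕ.* 3 ^ l) ℕ.* 3 ^ j)) % d
        ≡⟨ *-≋ 3q≋1 (*-≋ (t^l*3^l≋2^l l) (refl {x = 3 ^ j % d})) ⟩
      (1 ℕ.* (2 ^ l ℕ.* 3 ^ j)) % d
        ≡⟨ cong (_% d) (ℕₚ.*-identityˡ _) ⟩
      (2 ^ l ℕ.* 3 ^ j) % d ∎
      where
      open ≡-Reasoning
      rearrange : ∀ q x y z → q ℕ.* (x ℕ.* (3 ℕ.* (y ℕ.* z))) ≡ (3 ℕ.* q) ℕ.* ((x ℕ.* y) ℕ.* z)
      rearrange = ℕ-Solver.solve-∀

    q*t^l*3^k≋2^l*3^[k∸l∸1] : ∀ {l k} → l < k → q ℕ.* (t ^ l ℕ.* 3 ^ k) ≋ 2 ^ l ℕ.* 3 ^ (k ∸ l ∸ 1)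
    q*t^l*3^k≋2^l*3^[k∸l∸1] {l} {k} l<k =
      subst (λ k′ → q ℕ.* (t ^ l ℕ.* 3 ^ k′) ≋ 2 ^ l ℕ.* 3 ^ (k ∸ l ∸ 1)) (m<n⇒suc[m+[n∸m∸1]]≡n l<k)
            (q*t^l*3^[1+l+j]≋2^l*3^j l (k ∸ l ∸ 1))

·̂-assoc-ℕ : ∀ m m′ r → (+ m) ·̂ ((+ m′) ·̂ r) ≡ (+ (m ℕ.* m′)) ·̂ r
·̂-assoc-ℕ m m′ (mk n a) = cong (mk n) (begin
  + m ℤ.* (+ m′ ℤ.* a)    ≡⟨ ℤₚ.*-assoc (+ m) (+ m′) a ⟨
  (+ m ℤ.* + m′) ℤ.* a    ≡⟨ cong (ℤ._* a) (ℤₚ.pos-* m m′) ⟨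
  + (m ℕ.* m′) ℤ.* a      ∎)
  where open ≡-Reasoning

·̂-neg : ∀ c r → c ·̂ (-̂ r) ≡ -̂ (c ·̂ r)
·̂-neg c (mk n a) = cong (mk n) (sym (ℤₚ.neg-distribʳ-* c a))

iterate-P2 : ∀ q l n a → iterate (P2 q) l (mk n a) ≡ (+ ((2· q) n ^ l)) ·̂ mk n a
iterate-P2 q zero    n a = cong (mk n) (sym (ℤₚ.*-identityˡ a))
iterate-P2 q (suc l) n a = trans (cong (P2 q) (iterate-P2 q l n a))
                                 (·̂-assoc-ℕ ((2· q) n) ((2· q) n ^ l) (mk n a))

P-iterate-P2 : ∀ q l m n a → P q (iterate (P2 q) l ((+ m) ·̂ mk n a))
                                ≡ (+ (π q n ℕ.* ((2· q) n ^ l ℕ.* m))) ·̂ mk n a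
P-iterate-P2 q l m n a = begin
  P q (iterate (P2 q) l ((+ m) ·̂ mk n a))      ≡⟨ cong (P q) (iterate-P2 q l n (+ m ℤ.* a)) ⟩
  (+ π q n) ·̂ ((+ (t ^ l)) ·̂ ((+ m) ·̂ mk n a)) ≡⟨ cong ((+ π q n) ·̂_) (·̂-assoc-ℕ (t ^ l) m (mk n a)) ⟩
  (+ π q n) ·̂ ((+ (t ^ l ℕ.* m)) ·̂ mk n a)      ≡⟨ ·̂-assoc-ℕ (π q n) (t ^ l ℕ.* m) (mk n a) ⟩
  (+ (π q n ℕ.* (t ^ l ℕ.* m))) ·̂ mk n a        ∎
  where
  open ≡-Reasoning
  t = (2· q) n

+2^[n+n]≡+2^n*+2^n : ∀ n → + (2 ^ (n ℕ.+ n)) ≡ + (2 ^ n) ℤ.* + (2 ^ n)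
+2^[n+n]≡+2^n*+2^n n = trans (cong +_ (ℕₚ.^-distribˡ-+-* 2 n n)) (ℤₚ.pos-* (2 ^ n) (2 ^ n))

mk-cong : ∀ {n a b} → + (2 ^ n) Signed.∣ a ℤ.- b → mk n a ≈̂ mk n b
mk-cong {n} {a} {b} 2^n∣a-b =
  Signed.∣⇒∣ᵤ (subst₂ Signed._∣_ (sym (+2^[n+n]≡+2^n*+2^n n)) ([y-z]x≈yx-zx (+ (2 ^ n)) a b)
                                (Signed.*-monoˡ-∣ (+ (2 ^ n)) 2^n∣a-b))

-̂-cong : ∀ {r s} → r ≈̂ s → (-̂ r) ≈̂ (-̂ s)
-̂-cong {mk n a} {mk m b} r≈̂s = subst (2 ^ (n ℕ.+ m) ℕ∣.∣_) (sym ∣-[aM-bN]∣≡∣aM-bN∣) r≈̂s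
  where
  M = + (2 ^ m)
  N = + (2 ^ n)
  -a*M+b*N≡-[a*M-b*N] : ∀ a b M N → ℤ.- a ℤ.* M ℤ.- ℤ.- b ℤ.* N ≡ ℤ.- (a ℤ.* M ℤ.- b ℤ.* N)
  -a*M+b*N≡-[a*M-b*N] = ℤ-Solver.solve-∀
  ∣-[aM-bN]∣≡∣aM-bN∣ : ℤ.∣ ℤ.- a ℤ.* M ℤ.- ℤ.- b ℤ.* N ∣ ≡ ℤ.∣ a ℤ.* M ℤ.- b ℤ.* N ∣
  ∣-[aM-bN]∣≡∣aM-bN∣ = trans (cong ℤ.∣_∣ (-a*M+b*N≡-[a*M-b*N] a b M N))
                             (ℤₚ.∣-i∣≡∣i∣ (a ℤ.* M ℤ.- b ℤ.* N))

·̂-cong-%2^ : ∀ {m m′} n a → m %2^ n ≡ m′ %2^ n → ((+ m) ·̂ mk n a) ≈̂ ((+ m′) ·̂ mk n a)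
·̂-cong-%2^ {m} {m′} n a m≋m′ = mk-cong {n} {+ m ℤ.* a} {+ m′ ℤ.* a} 2^n∣ma-m′a
  where
  open Congruence (2 ^ n) {{ℕₚ.m^n≢0 2 n}}
  2^n∣ma-m′a : + (2 ^ n) Signed.∣ + m ℤ.* a ℤ.- + m′ ℤ.* a
  2^n∣ma-m′a = subst (+ (2 ^ n) Signed.∣_) ([y-z]x≈yx-zx a (+ m) (+ m′))
                     (Signed.∣m⇒∣m*n a (m≋n⇒d∣m-n m≋m′))

+̂-double : ∀ r → (r +̂ r) ≈̂ ((+ 2) ·̂ r)
+̂-double (mk n a) = subst (2 ^ ((n ℕ.+ n) ℕ.+ n) ℕ∣.∣_) (sym (cong ℤ.∣_∣ difference≡0)) (_ ℕ∣.∣0)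
  where
  N = + (2 ^ n)
  [aN+aN]N-2a[NN]≡0 : ∀ a N → (a ℤ.* N ℤ.+ a ℤ.* N) ℤ.* N ℤ.- (+ 2 ℤ.* a) ℤ.* (N ℤ.* N) ≡ + 0
  [aN+aN]N-2a[NN]≡0 = ℤ-Solver.solve-∀
  difference≡0 : (a ℤ.* N ℤ.+ a ℤ.* N) ℤ.* N ℤ.- (+ 2 ℤ.* a) ℤ.* + (2 ^ (n ℕ.+ n)) ≡ + 0
  difference≡0 = trans (cong (λ x → (a ℤ.* N ℤ.+ a ℤ.* N) ℤ.* N ℤ.- (+ 2 ℤ.* a) ℤ.* x) (+2^[n+n]≡+2^n*+2^n n))
                       ([aN+aN]N-2a[NN]≡0 a N)

module _ {c ℓ : Level} (R : CommutativeRing c ℓ) where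
  open CommutativeRing R hiding (refl; sym; trans; setoid)
  module ≈ = CommutativeRing R
  open SetoidReasoning ≈.setoid
  open CommutativeSemigroupProperties *-commutativeSemigroup using (interchange)

  ∏<-cong : ∀ k {f g : ℕ → Carrier} → (∀ l → l < k → f l ≈ g l) → ∏< R k f ≈ ∏< R k g
  ∏<-cong zero    f≈g = ≈.refl
  ∏<-cong (suc k) f≈g = *-cong (∏<-cong k (λ l l<k → f≈g l (ℕₚ.m<n⇒m<1+n l<k))) (f≈g k (ℕₚ.n<1+n k))

  ∏<-scale : ∀ k x (f : ℕ → Carrier) → ∏< R k (λ l → x * f l) ≈ pow R x k * ∏< R k f
  ∏<-scale zero    x f = ≈.sym (*-identityˡ 1#)
  ∏<-scale (suc k) x f = begin
    ∏< R k (λ l → x * f l) * (x * f k)    ≈⟨ *-congʳ (∏<-scale k x f) ⟩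
    (pow R x k * ∏< R k f) * (x * f k)    ≈⟨ interchange _ _ _ _ ⟩
    (pow R x k * x) * (∏< R k f * f k)    ∎

  module _ {e : X̂ → Carrier} (χ : IsCharacter R e) where
    open IsCharacter χ

    e-square : ∀ r → e r * e r ≈ e ((+ 2) ·̂ r)
    e-square r = ≈.trans (≈.sym (e-+ r r)) (resp (+̂-double r))

    e-neg-square : ∀ m r → e (-̂ ((+ m) ·̂ r)) * e (-̂ ((+ m) ·̂ r)) ≈ e (-̂ ((+ (2 ℕ.* m)) ·̂ r))
    e-neg-square m r = begin
      e (-̂ ((+ m) ·̂ r)) * e (-̂ ((+ m) ·̂ r))  ≈⟨ e-square (-̂ ((+ m) ·̂ r)) ⟩
      e ((+ 2) ·̂ (-̂ ((+ m) ·̂ r)))            ≡⟨ cong e (·̂-neg (+ 2) ((+ m) ·̂ r)) ⟩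
      e (-̂ ((+ 2) ·̂ ((+ m) ·̂ r)))            ≡⟨ cong (e ∘ -̂_) (·̂-assoc-ℕ 2 m r) ⟩
      e (-̂ ((+ (2 ℕ.* m)) ·̂ r))              ∎

lemma24 : ∀ {c ℓ : Level} (R : CommutativeRing c ℓ)
          (e : X̂ → CommutativeRing.Carrier R) → IsCharacter R e →
          (third : CommutativeRing.Carrier R) →
          CommutativeRing._≈_ R
            (CommutativeRing._*_ R (CommutativeRing._+_ R (CommutativeRing.1# R)
              (CommutativeRing._+_ R (CommutativeRing.1# R) (CommutativeRing.1# R))) third)
            (CommutativeRing.1# R) →
          (q : ℤ₂) → IsInverseOf3 q →
          (k : ℕ) → 1 ≤ k → (r : X̂) →
          CommutativeRing._≈_ R (Setup.M̃ R e third q k r) (Setup.RHS R e third q k r)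
-- The identity is formal in third.
lemma24 R e χ third _ q q⁻¹ k _ r@(mk n a) = R.trans (∏<-cong R k factor) (∏<-scale R k third _)
  where
  open CommutativeRing R hiding (refl; sym; trans; setoid)
  module R = CommutativeRing R
  open SetoidReasoning R.setoid
  open IsCharacter χ
  open Congruence (2 ^ n) {{ℕₚ.m^n≢0 2 n}} using (%-≋)
  open InverseOfThree {2 ^ n} {{ℕₚ.m^n≢0 2 n}} {π q n} {(2· q) n}

  factor : ∀ l → l < k →
           Setup.M R e third q (iterate (P2 q) l ((+ (3 ^ k)) ·̂ r))
           ≈ third * ((1# - e (-̂ ((+ (2 ^ l ℕ.* 3 ^ (k ∸ l ∸ 1))) ·̂ r)))
                      + e (-̂ ((+ (2 ^ suc l ℕ.* 3 ^ (k ∸ l ∸ 1))) ·̂ r)))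
  factor l l<k = *-congˡ (+-cong (+-congˡ (-‿cong E≈F)) (R.trans (*-cong E≈F E≈F) F²≈G))
    where
    j = k ∸ l ∸ 1
    B = 2 ^ l ℕ.* 3 ^ j
    c = π q n ℕ.* ((2· q) n ^ l ℕ.* 3 ^ k)
    c·r≈̂B·r : ((+ c) ·̂ r) ≈̂ ((+ B) ·̂ r)
    c·r≈̂B·r = ·̂-cong-%2^ n a (q*t^l*3^k≋2^l*3^[k∸l∸1] (q⁻¹ n) (%-≋ (2 ℕ.* π q n)) l<k)
    E≈F : e (-̂ P q (iterate (P2 q) l ((+ (3 ^ k)) ·̂ r))) ≈ e (-̂ ((+ B) ·̂ r))
    E≈F = begin
      e (-̂ P q (iterate (P2 q) l ((+ (3 ^ k)) ·̂ r)))  ≡⟨ cong (e ∘ -̂_) (P-iterate-P2 q l (3 ^ k) n a) ⟩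
      e (-̂ ((+ c) ·̂ r))                              ≈⟨ resp (-̂-cong {(+ c) ·̂ r} {(+ B) ·̂ r} c·r≈̂B·r) ⟩
      e (-̂ ((+ B) ·̂ r))                              ∎
    F²≈G : e (-̂ ((+ B) ·̂ r)) * e (-̂ ((+ B) ·̂ r)) ≈ e (-̂ ((+ (2 ^ suc l ℕ.* 3 ^ j)) ·̂ r))
    F²≈G = R.trans (e-neg-square R χ B r)
                   (R.reflexive (cong (λ m → e (-̂ ((+ m) ·̂ r))) (sym (ℕₚ.*-assoc 2 (2 ^ l) (3 ^ j)))))
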